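{- Let $q,n,t\in\mathbb{N}$ with $q\ge 2$ satisfy $\sum_{i=1}^{t} i\,q^{\lceil i/2\rceil}\ge n$. Let $A$ be an alphabet with $q$ letters. Then for every rich word $w$ over $A$ with $|w|=n$, the number $p$ of palindromes in the UPS-factorization $w=w_pw_{p-1}\cdots w_2w_1$ satisfies $p\le \sum_{i=1}^{t} q^{\lceil i/2\rceil}$.
   Context: A finite word $u=u_1\cdots u_n$ is a palindrome if $u_1u_2\cdots u_n=u_nu_{n-1}\cdots u_1$; the empty word is a palindrome. A word $w$ of length $n$ is rich if it has exactly $n+1$ distinct palindromic factors (including the empty word). For a rich word $w$, its UPS-factorization is the factorization $w=w_pw_{p-1}\cdots w_2w_1$ into non-empty palindromes $w_1,\dots,w_p$ such that, for each $i=1,\dots,p$, $w_i$ is the longest palindromic suffix of $w_pw_{p-1}\cdots w_i$; such a factorization exists for every rich word, and its palindromes are pairwise distinct. -}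

module Defs where

open import Data.Nat using (ℕ; zero; suc; _+_; _*_; _^_; _≤_; _/_)
open import Data.Fin using (Fin)
open import Data.List using (List; []; _∷_; _++_; reverse; length)
open import Data.List.Relation.Unary.Unique.Propositional using (Unique)
open import Data.List.Membership.Propositional using (_∈_)
open import Data.Product using (Σ; ∃; ∃-syntax; _×_; _,_)
open import Function.Bundles using (_⇔_)
open import Relation.Binary.PropositionalEquality using (_≡_)
open import Relation.Nullary using (¬_)

Palindrome : {A : Set} → List A → Set
Palindrome u = reverse u ≡ u

Factor : {A : Set} → List A → List A → Set
Factor u w = ∃[ x ] ∃[ y ] (x ++ u ++ y ≡ w)

Suffix : {A : Set} → List A → List A → Set
Suffix u w = ∃[ x ] (x ++ u ≡ w)

Rich : {A : Set} → List A → Set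
Rich {A} w = Σ (List (List A)) λ L →
  Unique L × (∀ u → (u ∈ L) ⇔ (Factor u w × Palindrome u)) × (length L ≡ suc (length w))

LongestPalSuffix : {A : Set} → List A → List A → Set
LongestPalSuffix u w =
  Suffix u w × Palindrome u × (∀ v → Suffix v w → Palindrome v → length v ≤ length u)

-- UPS w fs : fs = w₁ ∷ w₂ ∷ … ∷ w_p is the UPS-factorization of w = w_p ⋯ w₂ w₁
data UPS {A : Set} : List A → List (List A) → Set where
  ups-[] : UPS [] []
  ups-∷  : ∀ {v u fs} → ¬ (u ≡ []) → LongestPalSuffix u (v ++ u) →
           UPS v fs → UPS (v ++ u) (u ∷ fs)

ceilHalf : ℕ → ℕ
ceilHalf i = suc i / 2

sumLen : ℕ → ℕ → ℕ
sumLen q zero = 0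
sumLen q (suc t) = sumLen q t + suc t * q ^ ceilHalf (suc t)

sumCount : ℕ → ℕ → ℕ
sumCount q zero = 0
sumCount q (suc t) = sumCount q t + q ^ ceilHalf (suc t)

module Submission where

-- Each letter appended to a word creates at most one new palindromic factor, namely the longest
-- palindromic suffix of the extended word; hence a rich word gets a new palindrome at every step,
-- i.e. the longest palindromic suffix of each prefix occurs in that prefix only once. This is what
-- makes the palindromes of the UPS-factorization pairwise distinct. A palindrome of length i is
-- determined by its first ⌈i/2⌉ letters, so at most N i = q^⌈i/2⌉ of them have length i.
-- The rest is counting: if p positive lengths ℓ, at most N i of them equal to i, satisfy
-- Σ ℓ ≤ Σ_{i≤t} i N i, then (t+1) p ≤ Σ ℓ + Σ (t+1 ∸ ℓ), where
-- Σ (t+1 ∸ ℓ) = Σ_{s≤t} #{ℓ ≤ s} ≤ Σ_{i≤t} (t+1-i) N i; adding up gives (t+1) p ≤ (t+1) Σ_{i≤t} N i.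

open import Defs

open import Data.Bool using (true; false)
open import Data.Empty using (⊥-elim)
open import Data.Fin using (Fin)
open import Data.Fin.Properties using () renaming (_≟_ to _≟ᶠ_)
open import Data.List
  using (List; []; _∷_; _++_; [_]; _∷ʳ_; length; map; filter; reverse; take; drop;
         cartesianProductWith; initLast; _∷ʳ′_)
open import Data.List.Properties
  using (length-++; length-map; length-take; length-drop; length-reverse; length-removeAt′;
         length-tabulate; take-all; filter-accept; filter-reject; take++drop≡id; reverse-++; reverse-involutive;
         unfold-reverse; ++-assoc; ++-identityʳ; ++-conicalˡ; ++-conicalʳ; ∷-injectiveʳ; ∷ʳ-injective; ≡-dec)
open import Data.List.Membership.Propositional using (_∈_)
open import Data.List.Membership.Propositional.Properties
  using (∈-map⁻; ∈-cartesianProductWith⁺; ∈-allFin)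
open import Data.List.Relation.Binary.Subset.Propositional using (_⊆_)
open import Data.List.Relation.Unary.All as All using (All; []; _∷_)
open import Data.List.Relation.Unary.All.Properties using (all-filter; map⁺)
  renaming (filter⁺ to all-filter⁺)
open import Data.List.Relation.Unary.AllPairs using ([]; _∷_)
open import Data.List.Relation.Unary.Any using (here; there; _─_)
open import Data.List.Relation.Unary.Unique.Propositional using (Unique)
open import Data.List.Relation.Unary.Unique.Propositional.Properties
  using () renaming (filter⁺ to unique-filter⁺)
open import Data.Nat
  using (ℕ; zero; suc; _+_; _*_; _∸_; _^_; _≤_; _<_; z≤n; s≤s; _≟_; _≤?_; ⌊_/2⌋; ⌈_/2⌉)
open import Data.Nat.DivMod using (m/n≡1+[m∸n]/n)
open import Data.Nat.ListAction using (sum)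
open import Data.Nat.Properties
open import Algebra.Properties.CommutativeSemigroup +-commutativeSemigroup using (interchange; x∙yz≈y∙xz)
open import Data.Product using (∃-syntax; _×_; _,_; proj₁; proj₂)
open import Data.Sum using (_⊎_; inj₁; inj₂)
open import Function.Base using (_∘_)
open import Function.Bundles using (Equivalence)
open import Relation.Binary.Definitions using (DecidableEquality)
open import Relation.Binary.PropositionalEquality
  using (_≡_; _≢_; refl; sym; trans; cong; cong₂; subst; subst₂; module ≡-Reasoning)
open import Relation.Nullary using (¬_; yes; no; does)
open import Relation.Unary using (Decidable)

module _ {A : Set} where

  ∈-─⁺ : ∀ {x y : A} {xs} (x∈xs : x ∈ xs) → y ∈ xs → y ≢ x → y ∈ (xs ─ x∈xs)
  ∈-─⁺ (here refl)  (here refl)  y≢x = ⊥-elim (y≢x refl)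
  ∈-─⁺ (here refl)  (there y∈xs) _   = y∈xs
  ∈-─⁺ (there x∈xs) (here refl)  _   = here refl
  ∈-─⁺ (there x∈xs) (there y∈xs) y≢x = there (∈-─⁺ x∈xs y∈xs y≢x)

  unique⇒length-mono : ∀ {xs ys : List A} → Unique xs → xs ⊆ ys → length xs ≤ length ys
  unique⇒length-mono {[]}     _             _     = z≤n
  unique⇒length-mono {x ∷ xs} {ys} (x∉xs ∷ unique) xs⊆ys = begin
    suc (length xs)           ≤⟨ s≤s (unique⇒length-mono unique xs⊆ys─x) ⟩
    suc (length (ys ─ x∈ys))  ≡⟨ length-removeAt′ ys _ ⟨
    length ys                 ∎
    where
    open ≤-Reasoning
    x∈ys = xs⊆ys (here refl)
    xs⊆ys─x : xs ⊆ (ys ─ x∈ys)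
    xs⊆ys─x y∈xs = ∈-─⁺ x∈ys (xs⊆ys (there y∈xs)) (All.lookup x∉xs y∈xs ∘ sym)

  unique-map⁺ : ∀ {B : Set} {P : A → Set} {f : A → B} {xs} →
                (∀ {x y} → P x → P y → f x ≡ f y → x ≡ y) →
                All P xs → Unique xs → Unique (map f xs)
  unique-map⁺ f-inj []         []              = []
  unique-map⁺ f-inj (px ∷ pxs) (x∉xs ∷ unique) =
    map⁺ (All.map (λ (py , x≢y) → x≢y ∘ f-inj px py) (All.zip (pxs , x∉xs)))
    ∷ unique-map⁺ f-inj pxs unique

  length-filter-map : ∀ {B : Set} {P : B → Set} (P? : Decidable P) (f : A → B) xs →
                      length (filter P? (map f xs)) ≡ length (filter (P? ∘ f) xs)
  length-filter-map P? f []       = refl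
  length-filter-map P? f (x ∷ xs) with does (P? (f x))
  ... | true  = cong suc (length-filter-map P? f xs)
  ... | false = length-filter-map P? f xs

  take-++ˡ : ∀ n (xs ys : List A) → n ≤ length xs → take n (xs ++ ys) ≡ take n xs
  take-++ˡ zero    xs       ys _         = refl
  take-++ˡ (suc n) (x ∷ xs) ys (s≤s n≤m) = cong (x ∷_) (take-++ˡ n xs ys n≤m)

  take-length-++ : ∀ (xs ys : List A) → take (length xs) (xs ++ ys) ≡ xs
  take-length-++ xs ys = trans (take-++ˡ (length xs) xs ys ≤-refl) (take-all (length xs) xs ≤-refl)

module _ {A : Set} {P : A → Set} (P? : Decidable P) where

  length-filter-accept : ∀ {x} xs → P x → length (filter P? (x ∷ xs)) ≡ suc (length (filter P? xs))
  length-filter-accept xs px = cong length (filter-accept P? px)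

  length-filter-reject : ∀ {x} xs → ¬ P x → length (filter P? (x ∷ xs)) ≡ length (filter P? xs)
  length-filter-reject xs ¬px = cong length (filter-reject P? ¬px)

length-cartesianProductWith : ∀ {A B C : Set} (f : A → B → C) xs ys →
  length (cartesianProductWith f xs ys) ≡ length xs * length ys
length-cartesianProductWith f []       ys = refl
length-cartesianProductWith f (x ∷ xs) ys = begin
  length (map (f x) ys ++ cartesianProductWith f xs ys)  ≡⟨ length-++ (map (f x) ys) ⟩
  length (map (f x) ys) + length (cartesianProductWith f xs ys)
    ≡⟨ cong₂ _+_ (length-map (f x) ys) (length-cartesianProductWith f xs ys) ⟩
  length ys + length xs * length ys                      ∎
  where open ≡-Reasoning

n∸⌈n/2⌉≡⌊n/2⌋ : ∀ n → n ∸ ⌈ n /2⌉ ≡ ⌊ n /2⌋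
n∸⌈n/2⌉≡⌊n/2⌋ n = trans (cong (_∸ ⌈ n /2⌉) (sym (⌊n/2⌋+⌈n/2⌉≡n n))) (m+n∸n≡m ⌊ n /2⌋ ⌈ n /2⌉)

module _ {A : Set} where

  words : List A → ℕ → List (List A)
  words as zero    = [ [] ]
  words as (suc k) = cartesianProductWith _∷_ as (words as k)

  length-words : ∀ as k → length (words as k) ≡ length as ^ k
  length-words as zero    = refl
  length-words as (suc k) =
    trans (length-cartesianProductWith _∷_ as (words as k)) (cong (length as *_) (length-words as k))

  ∈-words : ∀ {as} → (∀ a → a ∈ as) → ∀ (u : List A) → u ∈ words as (length u)
  ∈-words as-complete []      = here refl
  ∈-words as-complete (a ∷ u) = ∈-cartesianProductWith⁺ _∷_ (as-complete a) (∈-words as-complete u)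

  length-take-⌈/2⌉ : ∀ {i} (u : List A) → length u ≡ i → length (take ⌈ i /2⌉ u) ≡ ⌈ i /2⌉
  length-take-⌈/2⌉ {i} u refl = trans (length-take ⌈ i /2⌉ u) (m≤n⇒m⊓n≡m (⌈n/2⌉≤n i))

  palindrome-suffix : ∀ (x y : List A) → Palindrome (x ++ y) → length y ≤ length x →
                      y ≡ reverse (take (length y) x)
  palindrome-suffix x y pal y≤x = begin
    y
      ≡⟨ reverse-involutive y ⟨
    reverse (reverse y)
      ≡⟨ cong reverse (take-length-++ (reverse y) (reverse x)) ⟨
    reverse (take (length (reverse y)) (reverse y ++ reverse x))
      ≡⟨ cong₂ (λ n z → reverse (take n z)) (length-reverse y) (trans (sym (reverse-++ x y)) pal) ⟩
    reverse (take (length y) (x ++ y))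
      ≡⟨ cong reverse (take-++ˡ (length y) x y y≤x) ⟩
    reverse (take (length y) x)
      ∎
    where open ≡-Reasoning

  palindrome-mirror : ∀ {i} (u : List A) → Palindrome u → length u ≡ i →
                      u ≡ take ⌈ i /2⌉ u ++ reverse (take ⌊ i /2⌋ (take ⌈ i /2⌉ u))
  palindrome-mirror {i} u pal |u|≡i = begin
    u                                  ≡⟨ take++drop≡id k u ⟨
    take k u ++ drop k u
      ≡⟨ cong (take k u ++_) (palindrome-suffix (take k u) (drop k u) pal′ |back|≤|front|) ⟩
    take k u ++ reverse (take (length (drop k u)) (take k u))
      ≡⟨ cong (λ n → take k u ++ reverse (take n (take k u))) |back|≡ ⟩
    take k u ++ reverse (take ⌊ i /2⌋ (take k u)) ∎
    where
    open ≡-Reasoning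
    k = ⌈ i /2⌉
    pal′ : Palindrome (take k u ++ drop k u)
    pal′ = subst Palindrome (sym (take++drop≡id k u)) pal
    |back|≡ : length (drop k u) ≡ ⌊ i /2⌋
    |back|≡ = trans (length-drop k u) (trans (cong (_∸ k) |u|≡i) (n∸⌈n/2⌉≡⌊n/2⌋ i))
    |back|≤|front| : length (drop k u) ≤ length (take k u)
    |back|≤|front| = subst₂ _≤_ (sym |back|≡) (sym (length-take-⌈/2⌉ u |u|≡i)) (⌊n/2⌋≤⌈n/2⌉ i)

  palindrome-half-injective : ∀ {i} {u v : List A} → Palindrome u → Palindrome v →
                              length u ≡ i → length v ≡ i →
                              take ⌈ i /2⌉ u ≡ take ⌈ i /2⌉ v → u ≡ v
  palindrome-half-injective {i} {u} {v} pal-u pal-v |u|≡i |v|≡i halves≡ = begin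
    u                  ≡⟨ palindrome-mirror u pal-u |u|≡i ⟩
    mirror (take k u)  ≡⟨ cong mirror halves≡ ⟩
    mirror (take k v)  ≡⟨ palindrome-mirror v pal-v |v|≡i ⟨
    v                  ∎
    where
    open ≡-Reasoning
    k = ⌈ i /2⌉
    mirror : List A → List A
    mirror h = h ++ reverse (take ⌊ i /2⌋ h)

  unique-palindromes-ofLength≤ : ∀ {as : List A} → (∀ a → a ∈ as) →
    ∀ {us} → Unique us → All Palindrome us → ∀ i →
    length (filter (_≟ i) (map length us)) ≤ length as ^ ⌈ i /2⌉
  unique-palindromes-ofLength≤ {as} as-complete {us} unique pals i = begin
    length (filter (_≟ i) (map length us))  ≡⟨ length-filter-map (_≟ i) length us ⟩
    length usᵢ                              ≡⟨ length-map (take k) usᵢ ⟨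
    length (map (take k) usᵢ)               ≤⟨ unique⇒length-mono halves-unique halves⊆words ⟩
    length (words as k)                     ≡⟨ length-words as k ⟩
    length as ^ k                           ∎
    where
    open ≤-Reasoning
    k = ⌈ i /2⌉
    usᵢ = filter ((_≟ i) ∘ length) us
    ofLength : All (λ u → Palindrome u × length u ≡ i) usᵢ
    ofLength = All.zip (all-filter⁺ _ pals , all-filter _ us)
    halves-unique : Unique (map (take k) usᵢ)
    halves-unique = unique-map⁺ (λ (pal-u , |u|≡i) (pal-v , |v|≡i) →
                                   palindrome-half-injective pal-u pal-v |u|≡i |v|≡i)
                                ofLength (unique-filter⁺ _ unique)
    halves⊆words : map (take k) usᵢ ⊆ words as k
    halves⊆words h∈halves with ∈-map⁻ (take k) h∈halves
    ... | u , u∈usᵢ , refl =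
      subst (λ n → take k u ∈ words as n) (length-take-⌈/2⌉ u (proj₂ (All.lookup ofLength u∈usᵢ)))
            (∈-words as-complete (take k u))

module _ (N : ℕ → ℕ) where

  sumUpTo : ℕ → ℕ
  sumUpTo zero    = 0
  sumUpTo (suc t) = sumUpTo t + N (suc t)

  weightedSumUpTo : ℕ → ℕ
  weightedSumUpTo zero    = 0
  weightedSumUpTo (suc t) = weightedSumUpTo t + suc t * N (suc t)

atMost : ℕ → List ℕ → ℕ
atMost s ls = length (filter (_≤? s) ls)

exactly : ℕ → List ℕ → ℕ
exactly i ls = length (filter (_≟ i) ls)

deficit : ℕ → List ℕ → ℕ
deficit m ls = sum (map (m ∸_) ls)

length*≤sum+deficit : ∀ m ls → length ls * m ≤ sum ls + deficit m ls
length*≤sum+deficit m []       = z≤n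
length*≤sum+deficit m (ℓ ∷ ls) = begin
  m + length ls * m                          ≤⟨ +-mono-≤ (m≤n+m∸n m ℓ) (length*≤sum+deficit m ls) ⟩
  (ℓ + (m ∸ ℓ)) + (sum ls + deficit m ls)    ≡⟨ interchange ℓ (m ∸ ℓ) (sum ls) (deficit m ls) ⟩
  (ℓ + sum ls) + ((m ∸ ℓ) + deficit m ls)    ∎
  where open ≤-Reasoning

deficit-suc : ∀ s ls → deficit (suc s) ls ≡ atMost s ls + deficit s ls
deficit-suc s []       = refl
deficit-suc s (ℓ ∷ ls) with ℓ ≤? s
... | yes ℓ≤s = begin
  suc s ∸ ℓ + deficit (suc s) ls
    ≡⟨ cong₂ _+_ (+-∸-assoc 1 ℓ≤s) (deficit-suc s ls) ⟩
  suc (s ∸ ℓ) + (atMost s ls + deficit s ls)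
    ≡⟨ cong suc (x∙yz≈y∙xz (s ∸ ℓ) (atMost s ls) (deficit s ls)) ⟩
  suc (atMost s ls) + (s ∸ ℓ + deficit s ls)
    ≡⟨ cong (_+ (s ∸ ℓ + deficit s ls)) (length-filter-accept (_≤? s) ls ℓ≤s) ⟨
  atMost s (ℓ ∷ ls) + deficit s (ℓ ∷ ls)
    ∎
  where open ≡-Reasoning
... | no ℓ≰s = begin
  suc s ∸ ℓ + deficit (suc s) ls
    ≡⟨ cong₂ _+_ (m≤n⇒m∸n≡0 s<ℓ) (deficit-suc s ls) ⟩
  atMost s ls + deficit s ls
    ≡⟨ cong₂ (λ a d → a + (d + deficit s ls))
             (length-filter-reject (_≤? s) ls ℓ≰s) (m≤n⇒m∸n≡0 (<⇒≤ s<ℓ)) ⟨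
  atMost s (ℓ ∷ ls) + deficit s (ℓ ∷ ls)
    ∎
  where
  open ≡-Reasoning
  s<ℓ = ≰⇒> ℓ≰s

atMost-suc : ∀ s ls → atMost (suc s) ls ≡ atMost s ls + exactly (suc s) ls
atMost-suc s []       = refl
atMost-suc s (ℓ ∷ ls) with ℓ ≤? s | ℓ ≟ suc s
... | yes ℓ≤s | _ = begin
  atMost (suc s) (ℓ ∷ ls)                ≡⟨ length-filter-accept (_≤? suc s) ls (m≤n⇒m≤1+n ℓ≤s) ⟩
  suc (atMost (suc s) ls)                ≡⟨ cong suc (atMost-suc s ls) ⟩
  suc (atMost s ls) + exactly (suc s) ls
    ≡⟨ cong₂ _+_ (length-filter-accept (_≤? s) ls ℓ≤s) (length-filter-reject (_≟ suc s) ls ℓ≢1+s) ⟨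
  atMost s (ℓ ∷ ls) + exactly (suc s) (ℓ ∷ ls)
    ∎
  where
  open ≡-Reasoning
  ℓ≢1+s : ℓ ≢ suc s
  ℓ≢1+s refl = 1+n≰n ℓ≤s
... | no ℓ≰s | yes refl = begin
  atMost (suc s) (ℓ ∷ ls)                ≡⟨ length-filter-accept (_≤? suc s) ls ≤-refl ⟩
  suc (atMost (suc s) ls)                ≡⟨ cong suc (atMost-suc s ls) ⟩
  suc (atMost s ls + exactly (suc s) ls) ≡⟨ +-suc _ _ ⟨
  atMost s ls + suc (exactly (suc s) ls)
    ≡⟨ cong₂ _+_ (length-filter-reject (_≤? s) ls ℓ≰s) (length-filter-accept (_≟ suc s) ls refl) ⟨
  atMost s (ℓ ∷ ls) + exactly (suc s) (ℓ ∷ ls)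
    ∎
  where open ≡-Reasoning
... | no ℓ≰s | no ℓ≢1+s = begin
  atMost (suc s) (ℓ ∷ ls)                ≡⟨ length-filter-reject (_≤? suc s) ls ℓ≰1+s ⟩
  atMost (suc s) ls                      ≡⟨ atMost-suc s ls ⟩
  atMost s ls + exactly (suc s) ls
    ≡⟨ cong₂ _+_ (length-filter-reject (_≤? s) ls ℓ≰s) (length-filter-reject (_≟ suc s) ls ℓ≢1+s) ⟨
  atMost s (ℓ ∷ ls) + exactly (suc s) (ℓ ∷ ls)
    ∎
  where
  open ≡-Reasoning
  ℓ≰1+s : ¬ ℓ ≤ suc s
  ℓ≰1+s ℓ≤1+s = ℓ≢1+s (≤-antisym ℓ≤1+s (≰⇒> ℓ≰s))

atMost-zero : ∀ {ls} → All (0 <_) ls → atMost 0 ls ≡ 0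
atMost-zero []          = refl
atMost-zero (0<ℓ ∷ pos) = trans (length-filter-reject (_≤? 0) _ (<⇒≱ 0<ℓ)) (atMost-zero pos)

deficit-one : ∀ {ls} → All (0 <_) ls → deficit 1 ls ≡ 0
deficit-one []          = refl
deficit-one (0<ℓ ∷ pos) = cong₂ _+_ (m≤n⇒m∸n≡0 0<ℓ) (deficit-one pos)

module _ (N : ℕ → ℕ) {ls : List ℕ} (positive : All (0 <_) ls)
         (exactly≤N : ∀ i → exactly i ls ≤ N i) where

  atMost≤sumUpTo : ∀ s → atMost s ls ≤ sumUpTo N s
  atMost≤sumUpTo zero    = ≤-reflexive (atMost-zero positive)
  atMost≤sumUpTo (suc s) = begin
    atMost (suc s) ls                    ≡⟨ atMost-suc s ls ⟩
    atMost s ls + exactly (suc s) ls     ≤⟨ +-mono-≤ (atMost≤sumUpTo s) (exactly≤N (suc s)) ⟩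
    sumUpTo N s + N (suc s)              ∎
    where open ≤-Reasoning

  deficit+weightedSumUpTo≤ : ∀ t → deficit (suc t) ls + weightedSumUpTo N t ≤ suc t * sumUpTo N t
  deficit+weightedSumUpTo≤ zero    = ≤-reflexive (trans (+-identityʳ _) (deficit-one positive))
  deficit+weightedSumUpTo≤ (suc t) = begin
    deficit (2 + t) ls + (W + (1 + t) * n)               ≡⟨ cong (_+ (W + (1 + t) * n)) (deficit-suc (suc t) ls) ⟩
    (atMost (suc t) ls + deficit (1 + t) ls) + (W + (1 + t) * n)
      ≡⟨ +-assoc-middle (atMost (suc t) ls) (deficit (1 + t) ls) W ((1 + t) * n) ⟩
    atMost (suc t) ls + ((deficit (1 + t) ls + W) + (1 + t) * n)
      ≤⟨ +-mono-≤ (atMost≤sumUpTo (suc t)) (+-monoˡ-≤ ((1 + t) * n) (deficit+weightedSumUpTo≤ t)) ⟩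
    S′ + ((1 + t) * S + (1 + t) * n)                      ≡⟨ cong (S′ +_) (*-distribˡ-+ (1 + t) S n) ⟨
    (2 + t) * S′                                          ∎
    where
    open ≤-Reasoning
    W = weightedSumUpTo N t
    S = sumUpTo N t
    n = N (suc t)
    S′ = sumUpTo N (suc t)
    +-assoc-middle : ∀ a d w m → (a + d) + (w + m) ≡ a + ((d + w) + m)
    +-assoc-middle a d w m = trans (+-assoc a d (w + m)) (cong (a +_) (sym (+-assoc d w m)))

  length≤sumUpTo : ∀ t → sum ls ≤ weightedSumUpTo N t → length ls ≤ sumUpTo N t
  length≤sumUpTo t sum≤ = *-cancelʳ-≤ (length ls) (sumUpTo N t) (suc t) (begin
    length ls * suc t                        ≤⟨ length*≤sum+deficit (suc t) ls ⟩
    sum ls + deficit (suc t) ls              ≤⟨ +-monoˡ-≤ (deficit (suc t) ls) sum≤ ⟩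
    weightedSumUpTo N t + deficit (suc t) ls ≡⟨ +-comm (weightedSumUpTo N t) (deficit (suc t) ls) ⟩
    deficit (suc t) ls + weightedSumUpTo N t ≤⟨ deficit+weightedSumUpTo≤ t ⟩
    suc t * sumUpTo N t                      ≡⟨ *-comm (suc t) (sumUpTo N t) ⟩
    sumUpTo N t * suc t                      ∎)
    where open ≤-Reasoning

module _ {A : Set} where

  suffix-length : ∀ {u w : List A} → Suffix u w → length u ≤ length w
  suffix-length {u} (x , refl) = subst (length u ≤_) (sym (length-++ x)) (m≤n+m (length u) (length x))

  suffix-∷ : ∀ {u c} {w : List A} → Suffix u (c ∷ w) → u ≡ c ∷ w ⊎ Suffix u w
  suffix-∷ ([]    , x++u≡) = inj₁ x++u≡
  suffix-∷ (_ ∷ x , x++u≡) = inj₂ (x , ∷-injectiveʳ x++u≡)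

  shorter-suffix : ∀ (x y : List A) {u v} → x ++ u ≡ y ++ v → length u ≤ length v → Suffix u v
  shorter-suffix x       []      x++u≡v _   = x , x++u≡v
  shorter-suffix []      (_ ∷ y) refl   u≤v = ⊥-elim (<⇒≱ (s≤s (suffix-length (y , refl))) u≤v)
  shorter-suffix (_ ∷ x) (_ ∷ y) x++u≡ u≤v = shorter-suffix x y (∷-injectiveʳ x++u≡) u≤v

  factor-++ʳ : ∀ {u w : List A} z → Factor u w → Factor u (w ++ z)
  factor-++ʳ {u} z (x , y , refl) =
    x , y ++ z , trans (cong (x ++_) (sym (++-assoc u y z))) (sym (++-assoc x (u ++ y) z))

  factor-∷ʳ⁻ : ∀ {u w : List A} {b} x y c → x ++ u ++ (y ∷ʳ c) ≡ w ∷ʳ b → Factor u w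
  factor-∷ʳ⁻ {u} {w} x y c eq = x , y , proj₁ (∷ʳ-injective (x ++ u ++ y) w (trans assoc eq))
    where
    assoc : (x ++ u ++ y) ∷ʳ c ≡ x ++ u ++ (y ∷ʳ c)
    assoc = trans (++-assoc x (u ++ y) [ c ]) (cong (x ++_) (++-assoc u y [ c ]))

  palindromicFactor-∷ʳ : ∀ {u v w : List A} {b} → Palindrome u → Factor u (w ∷ʳ b) →
                         LongestPalSuffix v (w ∷ʳ b) → Factor u w ⊎ u ≡ v
  palindromicFactor-∷ʳ {u} pal-u (x , y , eq) ((z , z++v≡) , pal-v , longest) with initLast y
  ... | y′ ∷ʳ′ c = inj₁ (factor-∷ʳ⁻ x y′ c eq)
  ... | [] with shorter-suffix x z (trans x++u≡ (sym z++v≡)) (longest u (x , x++u≡) pal-u)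
    where x++u≡ = trans (cong (x ++_) (sym (++-identityʳ u))) eq
  ...   | []    , refl = inj₂ refl
  ...   | c ∷ m , refl = inj₁ (factor-∷ʳ⁻ z (reverse m) c (trans (cong (z ++_) (sym v≡)) z++v≡))
    where
    v≡ : (c ∷ m) ++ u ≡ u ++ (reverse m ∷ʳ c)
    v≡ = begin
      (c ∷ m) ++ u                   ≡⟨ pal-v ⟨
      reverse ((c ∷ m) ++ u)         ≡⟨ reverse-++ (c ∷ m) u ⟩
      reverse u ++ reverse (c ∷ m)   ≡⟨ cong₂ _++_ pal-u (unfold-reverse c m) ⟩
      u ++ (reverse m ∷ʳ c)          ∎
      where open ≡-Reasoning

  PalCover : List A → List (List A) → Set
  PalCover w M = ∀ {u} → Factor u w → Palindrome u → u ∈ M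

  palCover-[] : PalCover [] [ [] ]
  palCover-[] {u} (x , y , x++u++y≡[]) _ = here (++-conicalˡ u y (++-conicalʳ x (u ++ y) x++u++y≡[]))

  palCover-∷ʳ : ∀ {w M v b} → PalCover w M → LongestPalSuffix v (w ∷ʳ b) → PalCover (w ∷ʳ b) (v ∷ M)
  palCover-∷ʳ cover lps u⊑wb pal-u with palindromicFactor-∷ʳ pal-u u⊑wb lps
  ... | inj₁ u⊑w = there (cover u⊑w pal-u)
  ... | inj₂ refl = here refl

  palCover-∷ʳ-known : ∀ {w M v b} → PalCover w M → LongestPalSuffix v (w ∷ʳ b) → Factor v w →
                    PalCover (w ∷ʳ b) M
  palCover-∷ʳ-known cover lps v⊑w u⊑wb pal-u with palindromicFactor-∷ʳ pal-u u⊑wb lps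
  ... | inj₁ u⊑w = cover u⊑w pal-u
  ... | inj₂ refl = cover v⊑w pal-u

  rich⇒length<palCover : ∀ {w M} → Rich w → PalCover w M → length w < length M
  rich⇒length<palCover (L , unique , L⇔ , |L|≡) cover =
    subst (_≤ _) |L|≡ (unique⇒length-mono unique L⊆M)
    where
    L⊆M : L ⊆ _
    L⊆M {u} u∈L = let (u⊑w , pal-u) = Equivalence.to (L⇔ u) u∈L in cover u⊑w pal-u

  -- Droubay, Justin and Pirillo: the longest palindromic suffix of every prefix is unioccurrent in it.
  LPSUnioccurrent : List A → Set
  LPSUnioccurrent w = ∀ {x a y u} → x ++ a ∷ y ≡ w → LongestPalSuffix u (x ∷ʳ a) → ¬ Factor u x

  lpsUnioccurrent-prefix : ∀ {v} u → LPSUnioccurrent (v ++ u) → LPSUnioccurrent v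
  lpsUnioccurrent-prefix {v} u unioccurrent {x} {a} {y} refl =
    unioccurrent (sym (++-assoc x (a ∷ y) u))

module _ {A : Set} (_≟ᴬ_ : DecidableEquality A) where

  longestPalSuffix : ∀ (w : List A) → ∃[ u ] LongestPalSuffix u w
  longestPalSuffix []      = [] , ([] , refl) , refl , λ _ s _ → suffix-length s
  longestPalSuffix (c ∷ w) with ≡-dec _≟ᴬ_ (reverse (c ∷ w)) (c ∷ w)
  ... | yes pal  = c ∷ w , ([] , refl) , pal , λ _ s _ → suffix-length s
  ... | no ¬pal with longestPalSuffix w
  ... | u , (x , x++u≡w) , pal-u , longest = u , (c ∷ x , cong (c ∷_) x++u≡w) , pal-u , longest′
    where
    longest′ : ∀ v → Suffix v (c ∷ w) → Palindrome v → length v ≤ length u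
    longest′ v s pal-v with suffix-∷ s
    ... | inj₁ refl = ⊥-elim (¬pal pal-v)
    ... | inj₂ s′   = longest v s′ pal-v

  palCover-++ : ∀ {w M} → PalCover w M → ∀ z →
                ∃[ M′ ] PalCover (w ++ z) M′ × length M′ ≤ length M + length z
  palCover-++ {w} {M} cover [] =
    M , subst (λ w′ → PalCover w′ M) (sym (++-identityʳ w)) cover , m≤m+n (length M) 0
  palCover-++ {w} cover (b ∷ z) with palCover-++ (palCover-∷ʳ cover (proj₂ (longestPalSuffix (w ∷ʳ b)))) z
  ... | M′ , cover′ , |M′|≤ =
    M′ , subst (λ w′ → PalCover w′ M′) (++-assoc w [ b ] z) cover′ ,
    ≤-trans |M′|≤ (≤-reflexive (sym (+-suc _ _)))

  rich⇒lpsUnioccurrent : ∀ {w : List A} → Rich w → LPSUnioccurrent w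
  rich⇒lpsUnioccurrent rich {x} {a} {y} refl lps v⊑x =
    let M  , coverˣ , |M|≤  = palCover-++ palCover-[] x
        M′ , cover  , |M′|≤ = palCover-++ (palCover-∷ʳ-known coverˣ lps v⊑x) y
        cover′ = subst (λ w → PalCover w M′) (++-assoc x [ a ] y) cover
    in <-irrefl refl (begin-strict
      suc (length x + length y)     ≡⟨ +-suc (length x) (length y) ⟨
      length x + suc (length y)     ≡⟨ length-++ x ⟨
      length (x ++ a ∷ y)           <⟨ rich⇒length<palCover rich cover′ ⟩
      length M′                     ≤⟨ |M′|≤ ⟩
      length M + length y           ≤⟨ +-monoˡ-≤ (length y) |M|≤ ⟩
      suc (length x) + length y     ∎)
    where open ≤-Reasoning

module _ {A : Set} where

  ups-palindromes : ∀ {w : List A} {fs} → UPS w fs → All Palindrome fs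
  ups-palindromes ups-[]            = []
  ups-palindromes (ups-∷ _ lps ups) = proj₁ (proj₂ lps) ∷ ups-palindromes ups

  ups-lengths-positive : ∀ {w : List A} {fs} → UPS w fs → All (0 <_) (map length fs)
  ups-lengths-positive ups-[]                         = []
  ups-lengths-positive (ups-∷ {u = []}    u≢[] _ _)   = ⊥-elim (u≢[] refl)
  ups-lengths-positive (ups-∷ {u = _ ∷ _} _    _ ups) = s≤s z≤n ∷ ups-lengths-positive ups

  ups-sum : ∀ {w : List A} {fs} → UPS w fs → sum (map length fs) ≡ length w
  ups-sum ups-[]                       = refl
  ups-sum (ups-∷ {v} {u} {fs} _ _ ups) = begin
    length u + sum (map length fs)  ≡⟨ cong (length u +_) (ups-sum ups) ⟩
    length u + length v             ≡⟨ +-comm (length u) (length v) ⟩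
    length v + length u             ≡⟨ length-++ v ⟨
    length (v ++ u)                 ∎
    where open ≡-Reasoning

  ups-factors : ∀ {w : List A} {fs} → UPS w fs → All (λ u → Factor u w) fs
  ups-factors ups-[]                  = []
  ups-factors (ups-∷ {v} {u} _ _ ups) =
    (v , [] , cong (v ++_) (++-identityʳ u)) ∷ All.map (factor-++ʳ u) (ups-factors ups)

  lpsUnioccurrent⇒¬Factor : ∀ {v u : List A} → LPSUnioccurrent (v ++ u) → u ≢ [] →
                            LongestPalSuffix u (v ++ u) → ¬ Factor u v
  lpsUnioccurrent⇒¬Factor {v} {u} unioccurrent u≢[] lps u⊑v with initLast u
  ... | []       = u≢[] refl
  ... | u′ ∷ʳ′ a = unioccurrent {x = v ++ u′} {y = []} (++-assoc v u′ [ a ])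
                     (subst (LongestPalSuffix (u′ ∷ʳ a)) (sym (++-assoc v u′ [ a ])) lps)
                     (factor-++ʳ u′ u⊑v)

  ups-unique : ∀ {w : List A} {fs} → LPSUnioccurrent w → UPS w fs → Unique fs
  ups-unique unioccurrent ups-[]                       = []
  ups-unique unioccurrent (ups-∷ {v} {u} u≢[] lps ups) =
    All.map (λ f⊑v u≡f → u⋢v (subst (λ f → Factor f v) (sym u≡f) f⊑v)) (ups-factors ups)
    ∷ ups-unique (lpsUnioccurrent-prefix u unioccurrent) ups
    where
    u⋢v = lpsUnioccurrent⇒¬Factor unioccurrent u≢[] lps

ceilHalf≡⌈n/2⌉ : ∀ n → ceilHalf n ≡ ⌈ n /2⌉
ceilHalf≡⌈n/2⌉ zero          = refl
ceilHalf≡⌈n/2⌉ (suc zero)    = refl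
ceilHalf≡⌈n/2⌉ (suc (suc n)) =
  trans (m/n≡1+[m∸n]/n {3 + n} {2} (s≤s (s≤s z≤n))) (cong suc (ceilHalf≡⌈n/2⌉ n))

module _ (q : ℕ) where

  sumCount≡sumUpTo : ∀ t → sumCount q t ≡ sumUpTo (λ i → q ^ ceilHalf i) t
  sumCount≡sumUpTo zero    = refl
  sumCount≡sumUpTo (suc t) = cong (_+ q ^ ceilHalf (suc t)) (sumCount≡sumUpTo t)

  sumLen≡weightedSumUpTo : ∀ t → sumLen q t ≡ weightedSumUpTo (λ i → q ^ ceilHalf i) t
  sumLen≡weightedSumUpTo zero    = refl
  sumLen≡weightedSumUpTo (suc t) = cong (_+ suc t * q ^ ceilHalf (suc t)) (sumLen≡weightedSumUpTo t)

lemma2 : (q n t : ℕ) → 2 ≤ q → n ≤ sumLen q t →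
         (w : List (Fin q)) → Rich w → length w ≡ n →
         (fs : List (List (Fin q))) → UPS w fs → length fs ≤ sumCount q t
lemma2 q n t _ n≤sumLen w rich refl fs ups = begin
  length fs               ≡⟨ length-map length fs ⟨
  length (map length fs)  ≤⟨ length≤sumUpTo N (ups-lengths-positive ups) exactly≤N t sum≤ ⟩
  sumUpTo N t             ≡⟨ sumCount≡sumUpTo q t ⟨
  sumCount q t            ∎
  where
  open ≤-Reasoning
  N = λ i → q ^ ceilHalf i
  distinct : Unique fs
  distinct = ups-unique (rich⇒lpsUnioccurrent _≟ᶠ_ rich) ups
  exactly≤N : ∀ i → exactly i (map length fs) ≤ N i
  exactly≤N i = subst₂ (λ m k → exactly i (map length fs) ≤ m ^ k)
                       (length-tabulate (λ x → x)) (sym (ceilHalf≡⌈n/2⌉ i))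
                       (unique-palindromes-ofLength≤ ∈-allFin distinct (ups-palindromes ups) i)
  sum≤ : sum (map length fs) ≤ weightedSumUpTo N t
  sum≤ = subst₂ _≤_ (sym (ups-sum ups)) (sumLen≡weightedSumUpTo q t) n≤sumLen
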